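{- Fix integers $b\geq 2$ and $N\geq 1$, and let \[ m_* := \Big\lceil \log_\varphi(2b^N) \Big\rceil + 4. \] For all integers $m\geq m_*$: if \[ F_{m+k} = b^t F_m + r \] for integers $k\geq 1$, $t$ with $1\leq t\leq N$, and $r$ with $0\leq r<b^t$, then necessarily $k\geq 2$, $F_{k+2}-F_{k-2} = b^t$, $k$ is odd, and $r=F_{m-k}$.
   Context: $(F_n)_{n\geq 0}$ denotes the Fibonacci sequence: $F_0=0$, $F_1=1$, $F_{n+1}=F_n+F_{n-1}$. $\varphi=\frac{1+\sqrt5}{2}$. -}

module Defs where

open import Data.Nat using (ℕ; zero; suc; _+_; _*_; _^_; _<_; _%_)
open import Data.Integer as ℤ using (ℤ; +_; -[1+_])
open import Data.Product using (_×_)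
open import Data.Sum using (_⊎_)
open import Relation.Nullary using (¬_)

fib : ℕ → ℕ
fib zero = zero
fib (suc zero) = suc zero
fib (suc (suc n)) = fib (suc n) + fib n

-- Lucas numbers L_n, so that φ^n = (L_n + F_n √5) / 2 for all n ≥ 0
lucas : ℕ → ℕ
lucas zero = 2
lucas (suc zero) = 1
lucas (suc (suc n)) = lucas (suc n) + lucas n

-- Fibonacci numbers at integer indices: F_{-n} = (-1)^(n+1) F_n
fibℤ : ℤ → ℤ
fibℤ (+ n) = + fib n
fibℤ -[1+ n ] with n % 2
... | zero = + fib (suc n)
... | suc _ = ℤ.- (+ fib (suc n))

-- "a · √5 ≥ c"  for a ∈ ℕ, c ∈ ℤ (exact, since √5 > 0)
sqrt5MulGe : ℕ → ℤ → Set
sqrt5MulGe a c = (c ℤ.≤ + 0) ⊎ (c ℤ.* c ℤ.≤ + (5 * (a * a)))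

-- "φ^j ≥ X"  where φ = (1+√5)/2, using φ^j = (L_j + F_j √5)/2,
-- i.e.  F_j √5 ≥ 2X − L_j
PhiPowGe : ℕ → ℕ → Set
PhiPowGe j X = sqrt5MulGe (fib j) ((+ (2 * X)) ℤ.- (+ lucas j))

-- c = ⌈log_φ X⌉ (for X ≥ 1, where this ceiling is a natural number):
-- c is the least natural number with φ^c ≥ X
IsCeilLogφ : ℕ → ℕ → Set
IsCeilLogφ X c = PhiPowGe c X × (∀ j → j < c → ¬ PhiPowGe j X)

-- For c = ⌈log_φ (2 b^N)⌉ we have 2 b^t ≤ φ^c ≤ F_{c+2}, so m ≥ c + 4 gives b^t < F_{c+2} ≤ F_{m-2}.
-- From F_{k+1} F_m ≤ F_{m+k} < (b^t + 1) F_m we get F_{k+1} ≤ b^t, so k ≤ c and j = m - k ≥ 4.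
-- The Lucas identity F_{m+k} = L_k F_m - (-1)^k F_j then decides everything. For odd k it is a
-- division of F_{m+k} by F_m with remainder F_j < F_m, so b^t = L_k = F_{k+2} - F_{k-2} and r = F_j,
-- and k = 1 is excluded by L_1 = 1. For even k it forces b^t < L_k, hence r ≥ F_m - F_j ≥ F_{m-1},
-- which exceeds b^t.

module Submission where

open import Defs
open import Data.Nat using (ℕ; _+_; _*_; _^_; _≤_; _<_; _∸_; _%_)
open import Data.Integer using (+_; _-_)
open import Data.Product using (_×_)
open import Relation.Binary.PropositionalEquality using (_≡_)

open import Function using (_∘_)
open import Data.Nat using (zero; suc; pred; _≤?_; _≤′_; ≤′-refl; ≤′-step; z≤n; s≤s; s≤s⁻¹; z<s; NonZero; >-nonZero)
open import Data.Nat.Properties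
open import Data.Nat.DivMod using ([m+kn]%n≡m%n; m<n⇒m%n≡m)
open import Data.Nat.Tactic.RingSolver using (solve-∀)
import Data.Integer as ℤ
open import Data.Integer using (-[1+_])
import Data.Integer.Properties as ℤₚ
open ℤₚ using (drop‿+≤+; pos-*; ≤-⊖; [+m]-[+n]≡m⊖n)
open import Data.Product using (_,_)
open import Data.Sum using (inj₁; inj₂)
open import Relation.Nullary using (yes; no; contradiction)
open import Relation.Binary.PropositionalEquality using (refl; sym; trans; cong; cong₂; subst; module ≡-Reasoning)

fib-≤-suc : ∀ n → fib n ≤ fib (suc n)
fib-≤-suc zero    = z≤n
fib-≤-suc (suc n) = m≤m+n (fib (suc n)) (fib n)

fib-mono-≤ : ∀ {m n} → m ≤ n → fib m ≤ fib n
fib-mono-≤ = mono′ ∘ ≤⇒≤′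
  where
  mono′ : ∀ {m n} → m ≤′ n → fib m ≤ fib n
  mono′ ≤′-refl            = ≤-refl
  mono′ (≤′-step {n} m≤n) = ≤-trans (mono′ m≤n) (fib-≤-suc n)

fib-suc>0 : ∀ n → 0 < fib (suc n)
fib-suc>0 zero    = z<s
fib-suc>0 (suc n) = ≤-trans (fib-suc>0 n) (m≤m+n _ _)

fib-mono-< : ∀ {m n} → 2 ≤ m → m < n → fib m < fib n
fib-mono-< {suc (suc m)} (s≤s (s≤s _)) m<n =
  <-≤-trans (m<m+n (fib (suc (suc m))) (fib-suc>0 m)) (fib-mono-≤ m<n)

fib-cancel-< : ∀ {m n} → fib m < fib n → m < n
fib-cancel-< fib[m]<fib[n] = ≰⇒> (<⇒≱ fib[m]<fib[n] ∘ fib-mono-≤)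

fib-+ : ∀ m n → fib (suc (m + n)) ≡ fib (suc m) * fib (suc n) + fib m * fib n
fib-+ zero    n = sym (trans (+-identityʳ _) (+-identityʳ _))
fib-+ (suc m) n = begin
  fib (suc (suc m + n))                                  ≡⟨ cong (fib ∘ suc) (sym (+-suc m n)) ⟩
  fib (suc (m + suc n))                                  ≡⟨ fib-+ m (suc n) ⟩
  fib (suc m) * fib (suc (suc n)) + fib m * fib (suc n)  ≡⟨ regroup (fib (suc m)) (fib (suc n)) (fib n) (fib m) ⟩
  fib (suc (suc m)) * fib (suc n) + fib (suc m) * fib n  ∎
  where
  open ≡-Reasoning
  regroup : ∀ a b c d → a * (b + c) + d * b ≡ (a + d) * b + a * c
  regroup = solve-∀

fib-suc*fib≤fib-+ : ∀ m k → fib (suc k) * fib m ≤ fib (m + k)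
fib-suc*fib≤fib-+ zero    k = ≤-trans (≤-reflexive (*-zeroʳ (fib (suc k)))) z≤n
fib-suc*fib≤fib-+ (suc m) k = begin
  fib (suc k) * fib (suc m)                   ≡⟨ *-comm (fib (suc k)) (fib (suc m)) ⟩
  fib (suc m) * fib (suc k)                   ≤⟨ m≤m+n _ _ ⟩
  fib (suc m) * fib (suc k) + fib m * fib k   ≡⟨ fib-+ m k ⟨
  fib (suc m + k)                             ∎
  where open ≤-Reasoning

fib-suc≤quotient : ∀ m k {q r} → r < fib m → fib (m + k) ≡ q * fib m + r → fib (suc k) ≤ q
fib-suc≤quotient m k {q} {r} r<fib[m] eq = s≤s⁻¹ (*-cancelʳ-< (fib m) (fib (suc k)) (suc q) (begin-strict
  fib (suc k) * fib m   ≤⟨ fib-suc*fib≤fib-+ m k ⟩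
  fib (m + k)           ≡⟨ eq ⟩
  q * fib m + r         <⟨ +-monoʳ-< (q * fib m) r<fib[m] ⟩
  q * fib m + fib m     ≡⟨ +-comm (q * fib m) (fib m) ⟩
  suc q * fib m         ∎))
  where open ≤-Reasoning

lucas-suc : ∀ n → lucas (suc n) ≡ fib (suc (suc n)) + fib n
lucas-suc zero          = refl
lucas-suc (suc zero)    = refl
lucas-suc (suc (suc n)) = trans (cong₂ _+_ (lucas-suc (suc n)) (lucas-suc n))
  (interchange (fib (suc (suc (suc n)))) (fib (suc n)) (fib (suc (suc n))) (fib n))
  where
  interchange : ∀ a b c d → (a + b) + (c + d) ≡ (a + c) + (b + d)
  interchange = solve-∀

2*fib[2+n]≡lucas[n]+3*fib[n] : ∀ n → 2 * fib (2 + n) ≡ lucas n + 3 * fib n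
2*fib[2+n]≡lucas[n]+3*fib[n] zero    = refl
2*fib[2+n]≡lucas[n]+3*fib[n] (suc n) =
  trans (expand (fib (suc n)) (fib n)) (cong (_+ 3 * fib (suc n)) (sym (lucas-suc n)))
  where
  expand : ∀ a b → 2 * ((a + b) + a) ≡ ((a + b) + b) + 3 * a
  expand = solve-∀

fib[k+2]≡lucas[k]+fib[k∸2] : ∀ k → 2 ≤ k → fib (k + 2) ≡ lucas k + fib (k ∸ 2)
fib[k+2]≡lucas[k]+fib[k∸2] (suc (suc n)) (s≤s (s≤s _)) = begin
  fib (suc (suc n) + 2)                                  ≡⟨ cong fib (+-comm (suc (suc n)) 2) ⟩
  fib (suc (suc (suc n))) + (fib (suc n) + fib n)        ≡⟨ +-assoc (fib (suc (suc (suc n)))) (fib (suc n)) (fib n) ⟨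
  fib (suc (suc (suc n))) + fib (suc n) + fib n          ≡⟨ cong (_+ fib n) (lucas-suc (suc n)) ⟨
  lucas (suc (suc n)) + fib n                            ∎
  where open ≡-Reasoning

-- L_k F_{k+j} = F_{2k+j} + (-1)^k F_j, with the sign moved to the side where it is a plus.
FibLucas⁻ : ℕ → Set
FibLucas⁻ k = ∀ j → fib (k + j + k) + fib j ≡ lucas k * fib (k + j)

FibLucas⁺ : ℕ → Set
FibLucas⁺ k = ∀ j → fib (k + j + k) ≡ lucas k * fib (k + j) + fib j

module FibLucasStep (k j : ℕ) where
  open ≡-Reasoning

  F₊ F₋ G : ℕ
  F₊ = fib (suc k + suc j + suc k)
  F₋ = fib (k + (2 + j) + k)
  G  = fib (2 + k + j)

  fib[2k+j+4] : fib (2 + k + j + (2 + k)) ≡ F₊ + F₋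
  fib[2k+j+4] = trans (cong fib (shift k j)) (cong (λ n → fib n + F₋) (shift′ k j))
    where
    shift : ∀ k j → 2 + k + j + (2 + k) ≡ 2 + (k + (2 + j) + k)
    shift = solve-∀
    shift′ : ∀ k j → 1 + (k + (2 + j) + k) ≡ suc k + suc j + suc k
    shift′ = solve-∀

  fib[k+1+j+1]≡G : fib (suc k + suc j) ≡ G
  fib[k+1+j+1]≡G = cong (fib ∘ suc) (+-suc k j)

  fib[k+j+2]≡G : fib (k + (2 + j)) ≡ G
  fib[k+j+2]≡G = cong fib (trans (+-suc k (suc j)) (cong suc (+-suc k j)))

  step⁻ : FibLucas⁻ k → FibLucas⁺ (suc k) → fib (2 + k + j + (2 + k)) + fib j ≡ lucas (2 + k) * G
  step⁻ idₖ idₖ₊₁ = +-cancelʳ-≡ (fib (suc j)) _ _ (begin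
    fib (2 + k + j + (2 + k)) + fib j + fib (suc j)       ≡⟨ cong (λ n → n + fib j + fib (suc j)) fib[2k+j+4] ⟩
    F₊ + F₋ + fib j + fib (suc j)                         ≡⟨ regroup F₊ F₋ (fib j) (fib (suc j)) ⟩
    F₊ + (F₋ + fib (2 + j))                               ≡⟨ cong₂ _+_ (idₖ₊₁ (suc j)) (idₖ (2 + j)) ⟩
    lucas (suc k) * fib (suc k + suc j) + fib (suc j) + lucas k * fib (k + (2 + j))
      ≡⟨ cong₂ (λ x y → lucas (suc k) * x + fib (suc j) + lucas k * y) fib[k+1+j+1]≡G fib[k+j+2]≡G ⟩
    lucas (suc k) * G + fib (suc j) + lucas k * G         ≡⟨ collect (lucas (suc k)) (lucas k) G (fib (suc j)) ⟩
    lucas (2 + k) * G + fib (suc j)                       ∎)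
    where
    regroup : ∀ p q a b → p + q + a + b ≡ p + (q + (b + a))
    regroup = solve-∀
    collect : ∀ x y g b → x * g + b + y * g ≡ (x + y) * g + b
    collect = solve-∀

  step⁺ : FibLucas⁺ k → FibLucas⁻ (suc k) → fib (2 + k + j + (2 + k)) ≡ lucas (2 + k) * G + fib j
  step⁺ idₖ idₖ₊₁ = +-cancelʳ-≡ (fib (suc j)) _ _ (begin
    fib (2 + k + j + (2 + k)) + fib (suc j)               ≡⟨ cong (_+ fib (suc j)) fib[2k+j+4] ⟩
    F₊ + F₋ + fib (suc j)                                 ≡⟨ regroup F₊ F₋ (fib (suc j)) ⟩
    (F₊ + fib (suc j)) + F₋                               ≡⟨ cong₂ _+_ (idₖ₊₁ (suc j)) (idₖ (2 + j)) ⟩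
    lucas (suc k) * fib (suc k + suc j) + (lucas k * fib (k + (2 + j)) + fib (2 + j))
      ≡⟨ cong₂ (λ x y → lucas (suc k) * x + (lucas k * y + fib (2 + j))) fib[k+1+j+1]≡G fib[k+j+2]≡G ⟩
    lucas (suc k) * G + (lucas k * G + (fib (suc j) + fib j))
      ≡⟨ collect (lucas (suc k)) (lucas k) G (fib (suc j)) (fib j) ⟩
    lucas (2 + k) * G + fib j + fib (suc j)               ∎)
    where
    regroup : ∀ p q b → p + q + b ≡ (p + b) + q
    regroup = solve-∀
    collect : ∀ x y g b a → x * g + (y * g + (b + a)) ≡ (x + y) * g + a + b
    collect = solve-∀

mutual
  fib-lucas-even : ∀ i → FibLucas⁻ (i * 2)
  fib-lucas-even zero    j =
    trans (cong (λ n → fib n + fib j) (+-identityʳ j)) (cong (λ n → fib j + n) (sym (+-identityʳ (fib j))))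
  fib-lucas-even (suc i) j = FibLucasStep.step⁻ (i * 2) j (fib-lucas-even i) (fib-lucas-odd i)

  fib-lucas-odd : ∀ i → FibLucas⁺ (suc (i * 2))
  fib-lucas-odd zero    j =
    trans (cong (fib ∘ suc) (+-comm j 1)) (cong (_+ fib j) (sym (+-identityʳ (fib (suc j)))))
  fib-lucas-odd (suc i) j = FibLucasStep.step⁺ (suc (i * 2)) j (fib-lucas-odd i) (fib-lucas-even (suc i))

data ParityView : ℕ → Set where
  even : ∀ i → ParityView (i * 2)
  odd  : ∀ i → ParityView (suc (i * 2))

parityView : ∀ n → ParityView n
parityView zero = even zero
parityView (suc n) with parityView n
... | even i = odd i
... | odd i  = even (suc i)

*+-unique : ∀ {d q₁ q₂ r₁ r₂} → r₁ < d → r₂ < d → q₁ * d + r₁ ≡ q₂ * d + r₂ → q₁ ≡ q₂ × r₁ ≡ r₂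
*+-unique {d} {q₁} {q₂} {r₁} {r₂} r₁<d r₂<d eq = *-cancelʳ-≡ q₁ q₂ d q₁*d≡q₂*d , r₁≡r₂
  where
  instance
    d≢0 : NonZero d
    d≢0 = >-nonZero (≤-<-trans z≤n r₁<d)
  open ≡-Reasoning
  r₁≡r₂ : r₁ ≡ r₂
  r₁≡r₂ = begin
    r₁                ≡⟨ m<n⇒m%n≡m r₁<d ⟨
    r₁ % d            ≡⟨ [m+kn]%n≡m%n r₁ q₁ d ⟨
    (r₁ + q₁ * d) % d ≡⟨ cong (_% d) (+-comm r₁ (q₁ * d)) ⟩
    (q₁ * d + r₁) % d ≡⟨ cong (_% d) eq ⟩
    (q₂ * d + r₂) % d ≡⟨ cong (_% d) (+-comm (q₂ * d) r₂) ⟩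
    (r₂ + q₂ * d) % d ≡⟨ [m+kn]%n≡m%n r₂ q₂ d ⟩
    r₂ % d            ≡⟨ m<n⇒m%n≡m r₂<d ⟩
    r₂                ∎
  q₁*d≡q₂*d : q₁ * d ≡ q₂ * d
  q₁*d≡q₂*d = +-cancelʳ-≡ r₁ _ _ (subst (λ r → q₁ * d + r₁ ≡ q₂ * d + r) (sym r₁≡r₂) eq)

*+≡*⇒≤ : ∀ {d q l s} → 0 < s → q * d + s ≡ l * d → d ≤ s
*+≡*⇒≤ {d} {q} {l} {s} s>0 eq = +-cancelˡ-≤ (q * d) d s (begin
  q * d + d  ≡⟨ +-comm (q * d) d ⟩
  suc q * d  ≤⟨ *-monoˡ-≤ d q<l ⟩
  l * d      ≡⟨ eq ⟨
  q * d + s  ∎)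
  where
  open ≤-Reasoning
  q<l : q < l
  q<l = *-cancelʳ-< d q l (subst (q * d <_) eq (m<m+n (q * d) s>0))

fib-lucas-odd-quotient : ∀ i j {B r} → let k = suc (i * 2) in
  2 ≤ j → r < fib (k + j) → fib (k + j + k) ≡ B * fib (k + j) + r → lucas k ≡ B × fib j ≡ r
fib-lucas-odd-quotient i j j≥2 r<fib eq =
  *+-unique (fib-mono-< j≥2 (s≤s (m≤n+m j (i * 2)))) r<fib (trans (sym (fib-lucas-odd i j)) eq)

fib-lucas-even-remainder : ∀ i j {B r} → let k = suc i * 2 in
  1 ≤ j → fib (k + j + k) ≡ B * fib (k + j) + r → fib (pred (k + j)) ≤ r
fib-lucas-even-remainder i (suc j) {B} {r} _ eq = +-cancelʳ-≤ F₂ F₁ r (begin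
  F₁ + F₂          ≤⟨ *+≡*⇒≤ {q = B} {l = lucas k} (<-≤-trans (fib-suc>0 j) (m≤n+m _ r)) B*F+r+fib[j]≡L*F ⟩
  r + fib (suc j)  ≤⟨ +-monoʳ-≤ r (fib-mono-≤ (m≤n+m (suc j) (i * 2))) ⟩
  r + F₂           ∎)
  where
  open ≤-Reasoning
  k F₁ F₂ : ℕ
  k  = suc i * 2
  F₁ = fib (suc (i * 2 + suc j))
  F₂ = fib (i * 2 + suc j)
  B*F+r+fib[j]≡L*F : B * (F₁ + F₂) + (r + fib (suc j)) ≡ lucas k * (F₁ + F₂)
  B*F+r+fib[j]≡L*F = trans (sym (+-assoc (B * (F₁ + F₂)) r (fib (suc j))))
    (trans (cong (_+ fib (suc j)) (sym eq)) (fib-lucas-even (suc i) (suc j)))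

fib-quotient-characterisation : ∀ k j {B r} → 1 ≤ k → 2 ≤ j → 2 ≤ B → r < fib (pred (k + j)) →
  fib (k + j + k) ≡ B * fib (k + j) + r →
  (2 ≤ k) × (fib (k + 2) ≡ B + fib (k ∸ 2)) × (k % 2 ≡ 1) × (r ≡ fib j)
fib-quotient-characterisation k j {B} {r} k≥1 j≥2 B≥2 r<fib eq with parityView k
... | even zero    = contradiction k≥1 λ ()
... | even (suc i) = contradiction (fib-lucas-even-remainder i j {B} (≤-trans (s≤s z≤n) j≥2) eq) (<⇒≱ r<fib)
... | odd i with fib-lucas-odd-quotient i j {B} j≥2 (<-≤-trans r<fib (fib-≤-suc (i * 2 + j))) eq
...   | L≡B , fib[j]≡r with i
...     | zero   = contradiction (≤-reflexive (sym L≡B)) (<⇒≱ B≥2)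
...     | suc i′ = s≤s (s≤s z≤n)
                 , trans (fib[k+2]≡lucas[k]+fib[k∸2] (suc (suc i′ * 2)) (s≤s (s≤s z≤n))) (cong (_+ fib (suc (i′ * 2))) L≡B)
                 , [m+kn]%n≡m%n 1 (suc i′) 2
                 , sym fib[j]≡r

3*a<n⇒5*a²<n² : ∀ {a n} → 3 * a < n → 5 * (a * a) < n * n
3*a<n⇒5*a²<n² {a} {n} 3a<n = begin-strict
  5 * (a * a)                                  <⟨ s≤s (m≤m+n _ _) ⟩
  suc (5 * (a * a) + (4 * (a * a) + 6 * a))    ≡⟨ square a ⟨
  suc (3 * a) * suc (3 * a)                    ≤⟨ *-mono-≤ 3a<n 3a<n ⟩
  n * n                                        ∎
  where
  open ≤-Reasoning
  square : ∀ a → suc (3 * a) * suc (3 * a) ≡ suc (5 * (a * a) + (4 * (a * a) + 6 * a))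
  square = solve-∀

sqrt5MulGe⇒≤3* : ∀ a c → sqrt5MulGe a c → c ℤ.≤ + (3 * a)
sqrt5MulGe⇒≤3* a c        (inj₁ c≤0)    = ℤₚ.≤-trans c≤0 (ℤ.+≤+ z≤n)
sqrt5MulGe⇒≤3* a -[1+ n ] (inj₂ _)      = ℤ.-≤+
sqrt5MulGe⇒≤3* a (+ n)    (inj₂ n²≤5a²) = ℤ.+≤+ (≮⇒≥ λ 3a<n → <⇒≱ (3*a<n⇒5*a²<n² {a} 3a<n) n²≤5a²′)
  where
  n²≤5a²′ : n * n ≤ 5 * (a * a)
  n²≤5a²′ = drop‿+≤+ (subst (ℤ._≤ + (5 * (a * a))) (sym (pos-* n n)) n²≤5a²)

⊖≤+⇒≤+ : ∀ m n {d} → m ℤ.⊖ n ℤ.≤ + d → m ≤ n + d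
⊖≤+⇒≤+ m n {d} m⊖n≤d with n ≤? m
... | yes n≤m = ≤-trans (m≤n+m∸n m n) (+-monoʳ-≤ n (drop‿+≤+ (subst (ℤ._≤ + d) (≤-⊖ n≤m) m⊖n≤d)))
... | no  n≰m = ≤-trans (<⇒≤ (≰⇒> n≰m)) (m≤m+n n d)

-- φ^c = (L_c + F_c √5) / 2 ≤ (L_c + 3 F_c) / 2 = F_{c+2}
PhiPowGe⇒≤fib : ∀ c X → PhiPowGe c X → X ≤ fib (2 + c)
PhiPowGe⇒≤fib c X φᶜ≥X = *-cancelˡ-≤ 2 (begin
  2 * X                ≤⟨ ⊖≤+⇒≤+ (2 * X) (lucas c) 2X⊖L≤3F ⟩
  lucas c + 3 * fib c  ≡⟨ 2*fib[2+n]≡lucas[n]+3*fib[n] c ⟨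
  2 * fib (2 + c)      ∎)
  where
  open ≤-Reasoning
  2X⊖L≤3F : 2 * X ℤ.⊖ lucas c ℤ.≤ + (3 * fib c)
  2X⊖L≤3F = subst (ℤ._≤ + (3 * fib c)) ([+m]-[+n]≡m⊖n (2 * X) (lucas c)) (sqrt5MulGe⇒≤3* (fib c) _ φᶜ≥X)

fib-quotient-for-large-index : ∀ c m k {B r} → 1 ≤ k → 2 ≤ B → B < fib (2 + c) → 4 + c ≤ m → r < B →
  fib (m + k) ≡ B * fib m + r →
  (2 ≤ k) × (fib (k + 2) ≡ B + fib (k ∸ 2)) × (k % 2 ≡ 1) × (+ r ≡ fibℤ (+ m - + k))
fib-quotient-for-large-index c m k {B} {r} k≥1 B≥2 B<fib[c+2] 4+c≤m r<B eq =
  let k≥2 , fib[k+2]≡B+fib[k∸2] , k-odd , r≡fib[j] =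
        fib-quotient-characterisation k j k≥1 j≥2 B≥2
          (subst (λ n → r < fib (pred n)) (sym k+j≡m) r<fib[m-1])
          (subst (λ n → fib (n + k) ≡ B * fib n + r) (sym k+j≡m) eq)
  in k≥2 , fib[k+2]≡B+fib[k∸2] , k-odd , trans (cong +_ r≡fib[j]) (cong fibℤ (sym m-k≡j))
  where
  r<fib[m-1] : r < fib (pred m)
  r<fib[m-1] = <-trans r<B (<-≤-trans B<fib[c+2] (fib-mono-≤ (≤-trans (n≤1+n (2 + c)) (pred-mono-≤ 4+c≤m))))
  k≤c : k ≤ c
  k≤c = ≤-pred (≤-pred (fib-cancel-<
          (≤-<-trans (fib-suc≤quotient m k (<-≤-trans r<fib[m-1] (fib-mono-≤ (pred[n]≤n {m}))) eq) B<fib[c+2])))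
  2+k≤m : 2 + k ≤ m
  2+k≤m = ≤-trans (+-monoʳ-≤ 2 k≤c) (≤-trans (m≤n+m (2 + c) 2) 4+c≤m)
  k≤m : k ≤ m
  k≤m = m+n≤o⇒n≤o 2 2+k≤m
  j : ℕ
  j = m ∸ k
  j≥2 : 2 ≤ j
  j≥2 = m+n≤o⇒m≤o∸n 2 2+k≤m
  k+j≡m : k + j ≡ m
  k+j≡m = m+[n∸m]≡n k≤m
  m-k≡j : + m - + k ≡ + j
  m-k≡j = trans ([+m]-[+n]≡m⊖n m k) (≤-⊖ k≤m)

lemma3p3 : (b N : ℕ) → 2 ≤ b → 1 ≤ N →
    (mstar₀ : ℕ) → IsCeilLogφ (2 * b ^ N) mstar₀ →
    (m : ℕ) → mstar₀ + 4 ≤ m →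
    (k t r : ℕ) → 1 ≤ k → 1 ≤ t → t ≤ N → r < b ^ t →
    fib (m + k) ≡ b ^ t * fib m + r →
    (2 ≤ k)
      × (fib (k + 2) ≡ b ^ t + fib (k ∸ 2))
      × (k % 2 ≡ 1)
      × (+ r ≡ fibℤ (+ m - + k))
lemma3p3 b N b≥2 _ c (φᶜ≥2bᴺ , _) m c+4≤m k t r k≥1 t≥1 t≤N r<bᵗ =
  fib-quotient-for-large-index c m k k≥1 bᵗ≥2 bᵗ<fib[c+2] (subst (_≤ m) (+-comm c 4) c+4≤m) r<bᵗ
  where
  instance
    b≢0 : NonZero b
    b≢0 = >-nonZero (≤-trans (s≤s z≤n) b≥2)
  bᵗ≥2 : 2 ≤ b ^ t
  bᵗ≥2 = ≤-trans b≥2 (≤-trans (≤-reflexive (sym (*-identityʳ b))) (^-monoʳ-≤ b t≥1))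
  bᵗ<fib[c+2] : b ^ t < fib (2 + c)
  bᵗ<fib[c+2] = begin-strict
    b ^ t          <⟨ m<m+n (b ^ t) (≤-trans (s≤s z≤n) bᵗ≥2) ⟩
    b ^ t + b ^ t  ≡⟨ cong (λ x → b ^ t + x) (+-identityʳ (b ^ t)) ⟨
    2 * b ^ t      ≤⟨ *-monoʳ-≤ 2 (^-monoʳ-≤ b t≤N) ⟩
    2 * b ^ N      ≤⟨ PhiPowGe⇒≤fib c (2 * b ^ N) φᶜ≥2bᴺ ⟩
    fib (2 + c)    ∎
    where open ≤-Reasoning
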